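{- Let $\Gamma$ be a finite simple graph and let $\omega\ge 2$ be an integer. If $\Gamma$ is $\omega$-clique regular, then $\omega=2$ or $\omega=\omega(\Gamma)$, where $\omega(\Gamma)$ is the clique number of $\Gamma$.
   Context: A clique of order $\omega$ (an $\omega$-clique) in a graph is a set of $\omega$ pairwise adjacent vertices (not required to be maximal). The clique number $\omega(\Gamma)$ is the maximum order of a clique in $\Gamma$. A graph $\Gamma$ is called $\omega$-clique regular if it has a nonempty edge set and every edge of $\Gamma$ is contained in exactly one clique of order $\omega$. -}

module Defs where

open import Level using (0ℓ)
open import Data.Nat using (ℕ; _≤_)
open import Data.Fin using (Fin)
open import Data.Fin.Subset using (Subset; _∈_; ∣_∣)
open import Data.Product using (Σ; ∃; _×_; _,_)
open import Relation.Nullary using (¬_; Dec)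
open import Relation.Binary.PropositionalEquality using (_≡_)

record SimpleGraph (n : ℕ) : Set₁ where
  field
    Adj     : Fin n → Fin n → Set
    adj?    : ∀ u v → Dec (Adj u v)
    irrefl  : ∀ v → ¬ Adj v v
    sym     : ∀ {u v} → Adj u v → Adj v u

open SimpleGraph public

IsClique : ∀ {n} → SimpleGraph n → Subset n → Set
IsClique G S = ∀ {u v} → u ∈ S → v ∈ S → ¬ (u ≡ v) → Adj G u v

-- A clique of order k (not required to be maximal).
IsKClique : ∀ {n} → SimpleGraph n → ℕ → Subset n → Set
IsKClique G k S = IsClique G S × ∣ S ∣ ≡ k

HasEdge : ∀ {n} → SimpleGraph n → Set
HasEdge G = ∃ λ u → ∃ λ v → Adj G u v

UniqueCliqueThrough : ∀ {n} → SimpleGraph n → ℕ → Fin n → Fin n → Set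
UniqueCliqueThrough G k u v =
  Σ (Subset _) λ S → (IsKClique G k S × u ∈ S × v ∈ S)
    × (∀ T → IsKClique G k T → u ∈ T → v ∈ T → T ≡ S)

CliqueRegular : ∀ {n} → SimpleGraph n → ℕ → Set
CliqueRegular G ω = HasEdge G × (∀ u v → Adj G u v → UniqueCliqueThrough G ω u v)

IsCliqueNumber : ∀ {n} → SimpleGraph n → ℕ → Set
IsCliqueNumber G c = (∃ λ S → IsKClique G c S) × (∀ S → IsClique G S → ∣ S ∣ ≤ c)

{-# OPTIONS --safe #-}
-- If ω ≥ 3 and K were a clique of order ω + 1, pick distinct u, v, x, y in K.
-- Both K - x and K - y are ω-cliques through the edge uv, so they coincide,
-- which is absurd since y lies in the first but not in the second. Hence
-- every clique has order at most ω, and the ω-clique through any edge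
-- realises the bound.
module Submission where

open import Defs hiding (sym)
open import Data.Nat using (ℕ; zero; suc; _+_; _≤_; _<_; s≤s)
open import Data.Nat.Properties using (≤-pred; <⇒≤; ≮⇒≥; m≤m+n; m≤n⇒m<n∨m≡n; suc-injective)
open import Data.Fin as Fin using (Fin)
open import Data.Fin.Subset
  using (Subset; Nonempty; _∈_; _∉_; _⊆_; ∣_∣; _─_; _-_; ⁅_⁆; ⊥; inside; outside)
open import Data.Fin.Subset.Properties
  using (⊥⊆; ∣⊥∣≡0; out⊆; in⊆in; p─⊥≡p; p─q⊆p; x∉⁅y⁆⇒x≢y; x∈p∧x≢y⇒x∈p-y)
open import Data.Vec using (_∷_; here; there)
open import Data.Product using (∃; ∃₂; _×_; _,_; proj₁; proj₂)
import Data.Product as Product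
open import Data.Sum using (_⊎_; inj₁; inj₂)
import Data.Empty as Empty
open import Relation.Nullary using (¬_)
open import Relation.Binary.PropositionalEquality
  using (_≡_; _≢_; refl; sym; trans; cong; subst; ≢-sym)

private
  variable
    n k : ℕ
    x y : Fin n
    p q : Subset n

x∈p─q⇒x∉q : x ∈ p ─ q → x ∉ q
x∈p─q⇒x∉q {p = _ ∷ _} {q = outside ∷ _} here ()
x∈p─q⇒x∉q {p = _ ∷ _} {q = _ ∷ _} (there x∈p─q) (there x∈q) = x∈p─q⇒x∉q x∈p─q x∈q

x∈p-y⇒x≢y : x ∈ p - y → x ≢ y
x∈p-y⇒x≢y x∈p-y = x∉⁅y⁆⇒x≢y (x∈p─q⇒x∉q x∈p-y)

x∈p-y⇒x∈p : x ∈ p - y → x ∈ p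
x∈p-y⇒x∈p {p = p} {y = y} = p─q⊆p p ⁅ y ⁆

x∈p⇒suc∣p-x∣≡∣p∣ : x ∈ p → suc ∣ p - x ∣ ≡ ∣ p ∣
x∈p⇒suc∣p-x∣≡∣p∣ {x = Fin.zero}  {inside ∷ p} here          = cong suc (cong ∣_∣ (p─⊥≡p p))
x∈p⇒suc∣p-x∣≡∣p∣ {x = Fin.suc _} {inside ∷ _} (there x∈p)  = cong suc (x∈p⇒suc∣p-x∣≡∣p∣ x∈p)
x∈p⇒suc∣p-x∣≡∣p∣ {x = Fin.suc _} {outside ∷ _} (there x∈p) = x∈p⇒suc∣p-x∣≡∣p∣ x∈p

p-x≢p-y : y ∈ p → x ≢ y → p - x ≢ p - y
p-x≢p-y y∈p x≢y p-x≡p-y =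
  x∈p-y⇒x≢y (subst (_ ∈_) p-x≡p-y (x∈p∧x≢y⇒x∈p-y y∈p (≢-sym x≢y))) refl

∣p∣>0⇒Nonempty : ∀ (p : Subset n) → 0 < ∣ p ∣ → Nonempty p
∣p∣>0⇒Nonempty (inside ∷ _)  _      = Fin.zero , here
∣p∣>0⇒Nonempty (outside ∷ p) 0<∣p∣ = Product.map Fin.suc there (∣p∣>0⇒Nonempty p 0<∣p∣)

∃-distinct-pair : 2 ≤ ∣ p ∣ → ∃₂ λ x y → x ∈ p × y ∈ p × x ≢ y
∃-distinct-pair {p = p} 2≤∣p∣ =
  let x , x∈p   = ∣p∣>0⇒Nonempty p (<⇒≤ 2≤∣p∣)
      y , y∈p-x = ∣p∣>0⇒Nonempty (p - x)
                    (≤-pred (subst (2 ≤_) (sym (x∈p⇒suc∣p-x∣≡∣p∣ x∈p)) 2≤∣p∣))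
  in x , y , x∈p , x∈p-y⇒x∈p y∈p-x , ≢-sym (x∈p-y⇒x≢y y∈p-x)

⊆-of-size : ∀ (p : Subset n) → k ≤ ∣ p ∣ → ∃ λ q → q ⊆ p × ∣ q ∣ ≡ k
⊆-of-size {n} {zero} p _ = ⊥ , ⊥⊆ , ∣⊥∣≡0 n
⊆-of-size {k = suc _} (outside ∷ p) k≤∣p∣ =
  let q , q⊆p , ∣q∣≡k = ⊆-of-size p k≤∣p∣ in outside ∷ q , out⊆ q⊆p , ∣q∣≡k
⊆-of-size {k = suc _} (inside ∷ p) (s≤s k≤∣p∣) =
  let q , q⊆p , ∣q∣≡k = ⊆-of-size p k≤∣p∣ in inside ∷ q , in⊆in q⊆p , cong suc ∣q∣≡k

module _ (G : SimpleGraph n) where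

  IsClique-⊆ : IsClique G p → q ⊆ p → IsClique G q
  IsClique-⊆ p-clique q⊆p x∈q y∈q = p-clique (q⊆p x∈q) (q⊆p y∈q)

  IsKClique-minus : IsKClique G (suc k) p → x ∈ p → IsKClique G k (p - x)
  IsKClique-minus {p = p} {x = x} (p-clique , ∣p∣≡1+k) x∈p =
    IsClique-⊆ p-clique (p─q⊆p p ⁅ x ⁆) ,
    suc-injective (trans (x∈p⇒suc∣p-x∣≡∣p∣ x∈p) ∣p∣≡1+k)

CliqueRegular⇒∃KClique : ∀ (G : SimpleGraph n) {ω} → CliqueRegular G ω → ∃ (IsKClique G ω)
CliqueRegular⇒∃KClique G ((u , v , uv) , unique-clique) =
  let S , (S-clique , _) , _ = unique-clique u v uv in S , S-clique

module _ (G : SimpleGraph n) {ω : ℕ}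
         (unique-clique : ∀ u v → Adj G u v → UniqueCliqueThrough G ω u v) where

  ¬KClique-suc-with-four-vertices :
    ∀ {K u v} → IsKClique G (suc ω) K → u ∈ K → v ∈ K → u ≢ v →
    x ∈ K - u - v → y ∈ K - u - v → x ≢ y → Empty.⊥
  ¬KClique-suc-with-four-vertices {x = x} {y} {K} {u} {v} K-clique u∈K v∈K u≢v x∈ y∈ x≢y =
    p-x≢p-y (x∈p-y⇒x∈p (x∈p-y⇒x∈p y∈)) x≢y (trans (K-z≡S x∈) (sym (K-z≡S y∈)))
    where
    S-unique = unique-clique u v (proj₁ K-clique u∈K v∈K u≢v)

    K-z≡S : ∀ {z} → z ∈ K - u - v → K - z ≡ proj₁ S-unique
    K-z≡S {z} z∈K-u-v =
      proj₂ (proj₂ S-unique) (K - z) (IsKClique-minus G K-clique z∈K)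
        (x∈p∧x≢y⇒x∈p-y u∈K (≢-sym (x∈p-y⇒x≢y z∈K-u)))
        (x∈p∧x≢y⇒x∈p-y v∈K (≢-sym (x∈p-y⇒x≢y z∈K-u-v)))
      where
      z∈K-u = x∈p-y⇒x∈p z∈K-u-v
      z∈K   = x∈p-y⇒x∈p z∈K-u

  ¬KClique-suc : 3 ≤ ω → ∀ K → ¬ IsKClique G (suc ω) K
  ¬KClique-suc (s≤s (s≤s (s≤s {n = r} _))) K K-clique@(_ , ∣K∣≡4+r) =
    let u , v , u∈K , v∈K , u≢v = ∃-distinct-pair (subst (2 ≤_) (sym ∣K∣≡4+r) (m≤m+n 2 (2 + r)))
        v∈K-u = x∈p∧x≢y⇒x∈p-y v∈K (≢-sym u≢v)
        _ , ∣K-u-v∣≡2+r = IsKClique-minus G (IsKClique-minus G K-clique u∈K) v∈K-u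
        x , y , x∈ , y∈ , x≢y = ∃-distinct-pair (subst (2 ≤_) (sym ∣K-u-v∣≡2+r) (m≤m+n 2 r))
    in ¬KClique-suc-with-four-vertices K-clique u∈K v∈K u≢v x∈ y∈ x≢y

  clique-order-≤ : 3 ≤ ω → ∀ S → IsClique G S → ∣ S ∣ ≤ ω
  clique-order-≤ 3≤ω S S-clique = ≮⇒≥ λ ω<∣S∣ →
    let K , K⊆S , ∣K∣≡1+ω = ⊆-of-size S ω<∣S∣
    in ¬KClique-suc 3≤ω K (IsClique-⊆ G S-clique K⊆S , ∣K∣≡1+ω)

theorem1 : ∀ {n} (G : SimpleGraph n) (ω : ℕ) → 2 ≤ ω → CliqueRegular G ω →
    ω ≡ 2 ⊎ IsCliqueNumber G ω
theorem1 G ω 2≤ω regular@(_ , unique-clique) with m≤n⇒m<n∨m≡n 2≤ω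
... | inj₂ 2≡ω = inj₁ (sym 2≡ω)
... | inj₁ 3≤ω = inj₂ (CliqueRegular⇒∃KClique G regular , clique-order-≤ G unique-clique 3≤ω)
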